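{- Let $\Phi$ be a derivation in system $\mathcal{N}$ of $\Gamma\vdash^{(0,0,s)} t:\sigma$. If $\Phi$ is tight and $t\in\mathsf{no}_n$, then $s=|t|_n$.
   Context: Terms are $t,u,r ::= x \mid \lambda x.t \mid t\,u \mid t[x\backslash u]$ over a countably infinite set of variables, where $t[x\backslash u]$ (explicit substitution) binds $x$ in $t$; terms are taken modulo $\alpha$-conversion. CBN neutral and normal terms: $\mathsf{ne}_n ::= x \mid \mathsf{ne}_n\, t$ and $\mathsf{no}_n ::= \lambda x.\mathsf{no}_n \mid \mathsf{ne}_n$. The $n$-size is $|x|_n=0$, $|\lambda x.t|_n = |t|_n+1$, $|t\,u|_n = |t|_n+1$, $|t[x\backslash u]|_n = |t|_n$. Types. Tight types: $\mathtt{tt} ::= \mathtt{n} \mid \mathtt{a}$. Types: $\sigma,\tau ::= \mathtt{tt} \mid \mathcal{M} \mid \mathcal{M}\to\sigma$, where multitypes $\mathcal{M} = [\sigma_i]_{i\in I}$ are finite multisets of types ($[\,]$ empty, $\sqcup$ union). A typing context $\Gamma$ maps variables to multitypes, $[\,]$ for all but finitely many; $\mathrm{dom}(\Gamma)=\{x \mid \Gamma(x)\neq[\,]\}$; $(\Gamma+\Delta)(x) = \Gamma(x)\sqcup\Delta(x)$, extended to finite sums $+_{i\in I}\Gamma_i$; $\Gamma\setminus\!\!\setminus x$ maps $x$ to $[\,]$ and agrees with $\Gamma$ elsewhere; $\Gamma; x:\mathcal{M}$ maps $x$ to $\mathcal{M}$ and agrees with $\Gamma$ elsewhere, where $x\notin\mathrm{dom}(\Gamma)$.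 Judgements $\Gamma \vdash^{(m,e,s)} t:\sigma$ carry natural-number counters. System $\mathcal{N}$ consists of the rules: (app$_p$) from $\Gamma\vdash^{(m,e,s)} t:\mathtt{n}$ infer $\Gamma\vdash^{(m,e,s+1)} t\,u:\mathtt{n}$; (abs$_p$) from $\Gamma\vdash^{(m,e,s)} t:\mathtt{tt}$ (a tight type) with $\Gamma(x)$ tight, infer $\Gamma\setminus\!\!\setminus x\vdash^{(m,e,s+1)}\lambda x.t:\mathtt{a}$; (var$_c$) $x:[\sigma]\vdash^{(0,0,0)} x:\sigma$; (abs$_c$) from $\Gamma\vdash^{(m,e,s)} t:\tau$ infer $\Gamma\setminus\!\!\setminus x\vdash^{(m,e,s)}\lambda x.t:\Gamma(x)\to\tau$; (app$_c$) from $\Gamma\vdash^{(m,e,s)} t:[\sigma_i]_{i\in I}\to\tau$ and $\Delta_i\vdash^{(m_i,e_i,s_i)} u:\sigma_i$ for each $i\in I$, infer $\Gamma+_{i\in I}\Delta_i\vdash^{(1+m+\sum_i m_i,\,1+e+\sum_i e_i,\,s+\sum_i s_i)} t\,u:\tau$; (es$_c$) from $\Gamma;x:[\sigma_i]_{i\in I}\vdash^{(m,e,s)} t:\tau$ and $\Delta_i\vdash^{(m_i,e_i,s_i)} u:\sigma_i$ for each $i\in I$, infer $(\Gamma\setminus\!\!\setminus x)+_{i\in I}\Delta_i\vdash^{(m+\sum_i m_i,\,1+e+\sum_i e_i,\,s+\sum_i s_i)} t[x\backslash u]:\tau$. A multitype is tight if all its elements are tight types; a context is tight if all multitypes it assigns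 are tight; a derivation of $\Gamma\vdash^{(m,e,s)} t:\sigma$ is tight if $\Gamma$ is tight and $\sigma$ is a tight type. -}

module Defs where

open import Data.Nat using (ℕ; zero; suc; _+_)
open import Data.Nat.Properties using (_≟_)
open import Data.List using (List; []; _∷_; [_]; _++_)
open import Data.List.Relation.Unary.All using (All)
open import Relation.Nullary using (yes; no)

Var : Set
Var = ℕ

data Term : Set where
  var : Var → Term
  lam : Var → Term → Term
  app : Term → Term → Term
  es  : Term → Var → Term → Term   -- es t x u  =  t[x\u]

mutual
  data NeN : Term → Set where
    ne-var : ∀ x → NeN (var x)
    ne-app : ∀ {t} u → NeN t → NeN (app t u)

  data NoN : Term → Set where
    no-lam : ∀ x {t} → NoN t → NoN (lam x t)
    no-ne  : ∀ {t} → NeN t → NoN t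

sizeN : Term → ℕ
sizeN (var x)    = 0
sizeN (lam x t)  = suc (sizeN t)
sizeN (app t u)  = suc (sizeN t)
sizeN (es t x u) = sizeN t

-- Types; multitypes are finite multisets, represented as lists
-- taken up to the (deep) permutation equivalence _≈M_ below.
data Ty : Set where
  tn  : Ty
  ta  : Ty
  mty : List Ty → Ty
  _⇒_ : List Ty → Ty → Ty

MTy : Set
MTy = List Ty

mutual
  data _≈T_ : Ty → Ty → Set where
    ≈tn  : tn ≈T tn
    ≈ta  : ta ≈T ta
    ≈mty : ∀ {M N} → M ≈M N → mty M ≈T mty N
    ≈⇒   : ∀ {M N σ τ} → M ≈M N → σ ≈T τ → (M ⇒ σ) ≈T (N ⇒ τ)

  data _≈M_ : MTy → MTy → Set where
    ≈[] : [] ≈M []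
    ≈∷  : ∀ {σ τ M} N₁ N₂ → σ ≈T τ → M ≈M (N₁ ++ N₂) →
          (σ ∷ M) ≈M (N₁ ++ τ ∷ N₂)

data TightTy : Ty → Set where
  tight-n : TightTy tn
  tight-a : TightTy ta

TightM : MTy → Set
TightM M = All TightTy M

Ctx : Set
Ctx = Var → MTy

TightCtx : Ctx → Set
TightCtx Γ = ∀ x → TightM (Γ x)

emptyCtx : Ctx
emptyCtx _ = []

_+C_ : Ctx → Ctx → Ctx
(Γ +C Δ) x = Γ x ++ Δ x

_∖∖_ : Ctx → Var → Ctx
(Γ ∖∖ x) y with y ≟ x
... | yes _ = []
... | no  _ = Γ y

single : Var → Ty → Ctx
single x σ y with y ≟ x
... | yes _ = [ σ ]
... | no  _ = []

mutual
  data _⊢⟨_,_,_⟩_∶_ : Ctx → ℕ → ℕ → ℕ → Term → Ty → Set where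
    app-p : ∀ {Γ m e s t} u →
            Γ ⊢⟨ m , e , s ⟩ t ∶ tn →
            Γ ⊢⟨ m , e , suc s ⟩ app t u ∶ tn
    abs-p : ∀ {Γ m e s t τ} x →
            TightTy τ → TightM (Γ x) →
            Γ ⊢⟨ m , e , s ⟩ t ∶ τ →
            (Γ ∖∖ x) ⊢⟨ m , e , suc s ⟩ lam x t ∶ ta
    var-c : ∀ x σ → single x σ ⊢⟨ 0 , 0 , 0 ⟩ var x ∶ σ
    abs-c : ∀ {Γ m e s t τ} x →
            Γ ⊢⟨ m , e , s ⟩ t ∶ τ →
            (Γ ∖∖ x) ⊢⟨ m , e , s ⟩ lam x t ∶ (Γ x ⇒ τ)
    app-c : ∀ {Γ Δ m e s m' e' s' t u M N τ} →
            Γ ⊢⟨ m , e , s ⟩ t ∶ (M ⇒ τ) →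
            Args Δ m' e' s' u N → M ≈M N →
            (Γ +C Δ) ⊢⟨ suc (m + m') , suc (e + e') , s + s' ⟩ app t u ∶ τ
    es-c  : ∀ {Γ Δ m e s m' e' s' t u N τ} x →
            Γ ⊢⟨ m , e , s ⟩ t ∶ τ →
            Args Δ m' e' s' u N → Γ x ≈M N →
            ((Γ ∖∖ x) +C Δ) ⊢⟨ m + m' , suc (e + e') , s + s' ⟩ es t x u ∶ τ

  -- a family of derivations Δ_i ⊢ u : σ_i (i ∈ I), with summed contexts/counters
  data Args : Ctx → ℕ → ℕ → ℕ → Term → MTy → Set where
    args-[] : ∀ {u} → Args emptyCtx 0 0 0 u []
    args-∷  : ∀ {Δ Δs m e s ms es' ss u σ σs} →
              Δ ⊢⟨ m , e , s ⟩ u ∶ σ →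
              Args Δs ms es' ss u σs →
              Args (Δ +C Δs) (m + ms) (e + es') (s + ss) u (σ ∷ σs)

TightDeriv : ∀ {Γ m e s t σ} → Γ ⊢⟨ m , e , s ⟩ t ∶ σ → Set
TightDeriv {Γ} {σ = σ} _ = TightCtx Γ × TightTy σ
  where open import Data.Product using (_×_)

{-# OPTIONS --safe #-}
module Submission where

-- Zero m- and e-counters rule out the consuming rules app_c and es_c (they
-- increment e), so a neutral term can only be typed by var_c and app_p, and
-- each app_p adds one to s for the application it types. A tight type for an
-- abstraction rules out abs_c (whose type is an arrow), so abs_p was used: it
-- adds one for the λ, and its premise is again tight because Γ(x) is tight.

open import Defs
open import Data.Nat using (ℕ; suc)
open import Data.Nat.Properties using (_≟_)
open import Data.Product using (_,_)
open import Relation.Nullary using (yes; no)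
open import Relation.Binary.PropositionalEquality using (_≡_; refl; cong)

neutral-size : ∀ {Γ s t σ} → Γ ⊢⟨ 0 , 0 , s ⟩ t ∶ σ → NeN t → s ≡ sizeN t
neutral-size (var-c x σ)     _                = refl
neutral-size (app-p u Φ)     (ne-app .u neT)  = cong suc (neutral-size Φ neT)
neutral-size (abs-p x _ _ _) ()
neutral-size (abs-c x _)     ()

tightCtx-∖∖⁻ : ∀ {Γ} x → TightCtx (Γ ∖∖ x) → TightM (Γ x) → TightCtx Γ
tightCtx-∖∖⁻ {Γ} x tightΓ∖∖x tightΓx y with y ≟ x | tightΓ∖∖x y
... | yes refl | _      = tightΓx
... | no  _    | tightY = tightY

lemma3p3 : ∀ {Γ : Ctx} {s : ℕ} {t : Term} {σ : Ty} →
    (Φ : Γ ⊢⟨ 0 , 0 , s ⟩ t ∶ σ) →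
    TightDeriv Φ → NoN t → s ≡ sizeN t
lemma3p3 Φ _ (no-ne neT) = neutral-size Φ neT
lemma3p3 (abs-p x tightτ tightΓx Φ) (tightΓ∖∖x , _) (no-lam .x noT) =
  cong suc (lemma3p3 Φ (tightCtx-∖∖⁻ x tightΓ∖∖x tightΓx , tightτ) noT)
lemma3p3 (abs-c x Φ) (_ , ()) (no-lam .x noT)
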